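{- Let $N$ be a net, $\sigma''\in\mathrm{FS}(N)$ and $\rho\in\mathrm{FS}^\infty(N)$. Then there exists $\rho^\dagger\in\mathrm{FS}^\infty(N)$ with $\sigma''\le\rho^\dagger\equiv_0^*\rho$ if and only if there exist $\sigma',\rho'\in\mathrm{FS}(N)$ with $\sigma''\le\sigma'\equiv_0^*\rho'\le\rho$.
   Context: A net is $N=(S,T,F,M_0)$ with $S,T$ disjoint, $F:(S\times T)\cup(T\times S)\to\mathbb{N}$, $M_0:S\to\mathbb{N}$, each transition having finitely many and at least one preplace and finitely many postplaces. ${}^\bullet x(y)=F(y,x)$, $x^\bullet(y)=F(x,y)$, extended additively to finite multisets. For markings $M,M'$ and finite non-empty multiset $G$ of transitions, $M\xrightarrow{G}M'$ iff ${}^\bullet G\le M$ and $M'=(M-{}^\bullet G)+G^\bullet$. For a finite or infinite word $\sigma=t_1t_2\cdots$, $M\xrightarrow{\sigma}$ means $M\xrightarrow{\{t_1\}}M_1\xrightarrow{\{t_2\}}\cdots$. $\mathrm{FS}^\infty(N)$: words with $M_0\xrightarrow{\sigma}$; $\mathrm{FS}(N)$: finite ones. $\le$ is the prefix order. For $\sigma,\rho\in\mathrm{FS}^\infty(N)$, $\sigma\equiv_0\rho$ iff $\sigma=\alpha tu\beta$, $\rho=\alpha ut\beta$ and $M_0\xrightarrow{\alpha}M\xrightarrow{\{t,u\}}$ for some $M$; $\equiv_0^*$ is the reflexive transitive closure of $\equiv_0$ on $\mathrm{FS}^\infty(N)$. -}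

module Defs where

open import Data.Nat using (ℕ; zero; suc; _+_; _∸_; _≤_)
open import Data.List using (List; []; _∷_; _++_; map)
open import Data.Nat.ListAction using (sum)
open import Data.List.Membership.Propositional using (_∈_)
open import Data.Product using (Σ; ∃; ∃-syntax; _×_; _,_)
open import Data.Empty using (⊥)
open import Relation.Binary.PropositionalEquality using (_≡_; _≢_)
open import Relation.Binary.Construct.Closure.ReflexiveTransitive using (Star)

-- A net N = (S, T, F, M₀).  S and T are separate types (hence disjoint).
-- F is split into  pre t s = F(s,t)  and  post t s = F(t,s).
record Net : Set₁ where
  field
    S    : Set
    T    : Set
    pre  : T → S → ℕ
    post : T → S → ℕ
    M₀   : S → ℕ
    pre-finite  : (t : T) → Σ (List S) λ ss → (s : S) → pre t s ≢ 0 → s ∈ ss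
    pre-nonempty : (t : T) → Σ S λ s → pre t s ≢ 0
    post-finite : (t : T) → Σ (List S) λ ss → (s : S) → post t s ≢ 0 → s ∈ ss

data Word (A : Set) : Set where
  fin : List A → Word A
  inf : (ℕ → A) → Word A

_≈w_ : {A : Set} → Word A → Word A → Set
fin a ≈w fin b = a ≡ b
fin _ ≈w inf _ = ⊥
inf _ ≈w fin _ = ⊥
inf f ≈w inf g = (n : ℕ) → f n ≡ g n

_++ω_ : {A : Set} → List A → (ℕ → A) → (ℕ → A)
([] ++ω f) n = f n
((x ∷ xs) ++ω f) zero = x
((x ∷ xs) ++ω f) (suc n) = (xs ++ω f) n

_++w_ : {A : Set} → List A → Word A → Word A
α ++w fin β = fin (α ++ β)
α ++w inf f = inf (α ++ω f)

_≼_ : {A : Set} → List A → Word A → Set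
α ≼ w = Σ (Word _) λ w' → w ≈w (α ++w w')

module _ (N : Net) where
  open Net N

  Marking : Set
  Marking = S → ℕ

  -- •G and G• for a finite multiset G of transitions (represented by a list)
  preM : List T → Marking
  preM G s = sum (map (λ t → pre t s) G)

  postM : List T → Marking
  postM G s = sum (map (λ t → post t s) G)

  Step : Marking → List T → Marking → Set
  Step M G M' = (G ≢ []) × ((s : S) → preM G s ≤ M s)
              × ((s : S) → M' s ≡ (M s ∸ preM G s) + postM G s)

  data Fires : Marking → List T → Marking → Set where
    done : {M : Marking} → Fires M [] M
    step : {M M₁ M' : Marking} {t : T} {σ : List T}
         → Step M (t ∷ []) M₁ → Fires M₁ σ M' → Fires M (t ∷ σ) M'

  FiresInf : Marking → (ℕ → T) → Set
  FiresInf M f = Σ (ℕ → Marking) λ Ms →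
      Step M (f 0 ∷ []) (Ms 0) × ((n : ℕ) → Step (Ms n) (f (suc n) ∷ []) (Ms (suc n)))

  FSω : Word T → Set
  FSω (fin σ) = ∃[ M ] Fires M₀ σ M
  FSω (inf f) = FiresInf M₀ f

  FS : List T → Set
  FS σ = ∃[ M ] Fires M₀ σ M

  _≡₀_ : Word T → Word T → Set
  σ ≡₀ ρ = FSω σ × FSω ρ ×
    Σ (List T) λ α → Σ T λ t → Σ T λ u → Σ (Word T) λ β → Σ Marking λ M →
      (σ ≈w (α ++w ((t ∷ u ∷ []) ++w β))) ×
      (ρ ≈w (α ++w ((u ∷ t ∷ []) ++w β))) ×
      Fires M₀ α M × (∃[ M' ] Step M (t ∷ u ∷ []) M')

  _≡₀*_ : Word T → Word T → Set
  _≡₀*_ = Star _≡₀_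

{-# OPTIONS --safe #-}
module Submission where

open import Defs
open import Data.Nat using (ℕ; zero; suc; _+_; _∸_; _≤_)
open import Data.Nat.Properties
  using (≤-refl; +-comm; +-assoc; +-∸-comm; ∸-+-assoc; m+n≤o⇒m≤o∸n; m+n≤o⇒m≤o; m+n≤o⇒n≤o; m≤n⇒m≤n+o; m+[n∸m]≡n)
open import Data.Nat.ListAction.Properties using (sum-++)
open import Data.List using (List; []; _∷_; _++_; length; take; drop)
open import Data.List.Properties using (++-assoc; take++drop≡id)
open import Data.Product using (Σ; _×_; _,_; proj₁; ∃)
open import Data.Empty using (⊥-elim)
open import Function using (_∘_)
open import Function.Bundles using (_⇔_; mk⇔)
open import Relation.Nullary using (¬_)
open import Relation.Binary.PropositionalEquality
open import Relation.Binary.Construct.Closure.ReflexiveTransitive using (Star; ε; _◅_)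

-- A swap at position |α| is still
-- a swap in every prefix of length ≥ |α| + 2, so a chain ρ† ≡₀* ρ restricts to
-- a chain between prefixes long enough to contain σ''.  Conversely, a chain
-- σ' ≡₀* ρ' of finite words extends by the suffix γ with ρ = ρ'γ, proceeding
-- from the ρ end: if t and u are concurrently enabled at M, firing u t or t u
-- from M reaches the same marking, so the swapped word fires whenever the
-- original one does.

module _ {A : Set} where

  ≈w-refl : {w : Word A} → w ≈w w
  ≈w-refl {fin a} = refl
  ≈w-refl {inf f} = λ _ → refl

  ≈w-sym : {w w' : Word A} → w ≈w w' → w' ≈w w
  ≈w-sym {fin _} {fin _} e = sym e
  ≈w-sym {inf _} {inf _} e = sym ∘ e

  ≈w-trans : {w w' w'' : Word A} → w ≈w w' → w' ≈w w'' → w ≈w w''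
  ≈w-trans {fin _} {fin _} {fin _} e e' = trans e e'
  ≈w-trans {inf _} {inf _} {inf _} e e' = λ n → trans (e n) (e' n)

  ++ω-congʳ : (α : List A) {f g : ℕ → A} → f ≗ g → (α ++ω f) ≗ (α ++ω g)
  ++ω-congʳ []      e n       = e n
  ++ω-congʳ (x ∷ α) e zero    = refl
  ++ω-congʳ (x ∷ α) e (suc n) = ++ω-congʳ α e n

  ++w-congʳ : (α : List A) {w w' : Word A} → w ≈w w' → (α ++w w) ≈w (α ++w w')
  ++w-congʳ α {fin _} {fin _} e = cong (α ++_) e
  ++w-congʳ α {inf _} {inf _} e = ++ω-congʳ α e

  ++ω-assoc : (α β : List A) (f : ℕ → A) → ((α ++ β) ++ω f) ≗ (α ++ω (β ++ω f))
  ++ω-assoc []      β f n       = refl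
  ++ω-assoc (x ∷ α) β f zero    = refl
  ++ω-assoc (x ∷ α) β f (suc n) = ++ω-assoc α β f n

  ++w-assoc : (α β : List A) (w : Word A) → ((α ++ β) ++w w) ≈w (α ++w (β ++w w))
  ++w-assoc α β (fin l) = ++-assoc α β l
  ++w-assoc α β (inf f) = ++ω-assoc α β f

  takeω : ℕ → (ℕ → A) → List A
  takeω zero    f = []
  takeω (suc m) f = f 0 ∷ takeω m (f ∘ suc)

  takeW : ℕ → Word A → List A
  takeW m (fin l) = take m l
  takeW m (inf f) = takeω m f

  dropW : ℕ → Word A → Word A
  dropW m (fin l) = fin (drop m l)
  dropW m (inf f) = inf (λ n → f (m + n))

  takeω-cong : ∀ m {f g : ℕ → A} → f ≗ g → takeω m f ≡ takeω m g
  takeω-cong zero    e = refl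
  takeω-cong (suc m) e = cong₂ _∷_ (e 0) (takeω-cong m (e ∘ suc))

  takeW-cong : ∀ m {w w' : Word A} → w ≈w w' → takeW m w ≡ takeW m w'
  takeW-cong m {fin _} {fin _} e = cong (take m) e
  takeW-cong m {inf _} {inf _} e = takeω-cong m e

  takeW-[]++w : ∀ m (w : Word A) → takeW m ([] ++w w) ≡ takeW m w
  takeW-[]++w m (fin l) = refl
  takeW-[]++w m (inf f) = refl

  takeW-∷++w : ∀ m x α (w : Word A) → takeW (suc m) ((x ∷ α) ++w w) ≡ x ∷ takeW m (α ++w w)
  takeW-∷++w m x α (fin l) = refl
  takeW-∷++w m x α (inf f) = refl

  takeW-++w : ∀ (α : List A) k w → takeW (length α + k) (α ++w w) ≡ α ++ takeW k w
  takeW-++w []      k w = takeW-[]++w k w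
  takeW-++w (x ∷ α) k w = trans (takeW-∷++w (length α + k) x α w) (cong (x ∷_) (takeW-++w α k w))

  takeW-≈++w : ∀ {α : List A} {w w'} m → w ≈w (α ++w w') → length α ≤ m
             → takeW m w ≡ α ++ takeW (m ∸ length α) w'
  takeW-≈++w {α} {w} {w'} m e le = begin
    takeW m w                                        ≡⟨ takeW-cong m e ⟩
    takeW m (α ++w w')                               ≡⟨ cong (λ j → takeW j (α ++w w')) (sym (m+[n∸m]≡n le)) ⟩
    takeW (length α + (m ∸ length α)) (α ++w w')     ≡⟨ takeW-++w α (m ∸ length α) w' ⟩
    α ++ takeW (m ∸ length α) w'                     ∎
    where open ≡-Reasoning

  takeω++dropω : ∀ m (f : ℕ → A) → f ≗ (takeω m f ++ω (λ n → f (m + n)))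
  takeω++dropω zero    f n       = refl
  takeω++dropω (suc m) f zero    = refl
  takeω++dropω (suc m) f (suc n) = takeω++dropω m (f ∘ suc) n

  takeW++dropW : ∀ m (w : Word A) → w ≈w (takeW m w ++w dropW m w)
  takeW++dropW m (fin l) = sym (take++drop≡id m l)
  takeW++dropW m (inf f) = takeω++dropω m f

  takeW-≼ : ∀ m (w : Word A) → takeW m w ≼ w
  takeW-≼ m w = dropW m w , takeW++dropW m w

  ≼-takeW : ∀ {α : List A} {w} m → α ≼ w → length α ≤ m → α ≼ fin (takeW m w)
  ≼-takeW {α} m (w' , e) le = fin (takeW (m ∸ length α) w') , takeW-≈++w m e le

  ≼-≈++w : ∀ {α β : List A} {γ w} → α ≼ fin β → w ≈w (β ++w γ) → α ≼ w
  ≼-≈++w {α} {γ = γ} (fin l , refl) e = l ++w γ , ≈w-trans e (++w-assoc α l γ)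

[m∸q+d]∸p+c≡[m∸p+c]∸q+d : ∀ m p q c d → p + q ≤ m → (m ∸ q + d) ∸ p + c ≡ (m ∸ p + c) ∸ q + d
[m∸q+d]∸p+c≡[m∸p+c]∸q+d m p q c d p+q≤m = begin
  (m ∸ q + d) ∸ p + c   ≡⟨ normalise p q c d p+q≤m ⟩
  m ∸ (q + p) + (d + c) ≡⟨ cong₂ (λ x y → m ∸ x + y) (+-comm q p) (+-comm d c) ⟩
  m ∸ (p + q) + (c + d) ≡⟨ sym (normalise q p d c (subst (_≤ m) (+-comm p q) p+q≤m)) ⟩
  (m ∸ p + c) ∸ q + d   ∎
  where
  open ≡-Reasoning
  normalise : ∀ p q c d → p + q ≤ m → (m ∸ q + d) ∸ p + c ≡ m ∸ (q + p) + (d + c)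
  normalise p q c d le = begin
    (m ∸ q + d) ∸ p + c   ≡⟨ cong (_+ c) (+-∸-comm d (m+n≤o⇒m≤o∸n p le)) ⟩
    (m ∸ q ∸ p + d) + c   ≡⟨ +-assoc (m ∸ q ∸ p) d c ⟩
    m ∸ q ∸ p + (d + c)   ≡⟨ cong (_+ (d + c)) (∸-+-assoc m q p) ⟩
    m ∸ (q + p) + (d + c) ∎

module _ (N : Net) where
  open Net N

  Fireable : Marking N → Word T → Set
  Fireable M (fin σ) = ∃ (Fires N M σ)
  Fireable M (inf f) = FiresInf N M f

  FSω→Fireable : ∀ w → FSω N w → Fireable M₀ w
  FSω→Fireable (fin _) e = e
  FSω→Fireable (inf _) e = e

  Fireable→FSω : ∀ w → Fireable M₀ w → FSω N w
  Fireable→FSω (fin _) e = e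
  Fireable→FSω (inf _) e = e

  Step-respˡ : ∀ {M M' G X} → M ≗ M' → Step N M G X → Step N M' G X
  Step-respˡ {G = G} M≗M' (G≢[] , •G≤M , X≡) =
    G≢[] ,
    (λ s → subst (preM N G s ≤_) (M≗M' s) (•G≤M s)) ,
    (λ s → trans (X≡ s) (cong (λ v → v ∸ preM N G s + postM N G s) (M≗M' s)))

  Step-functional : ∀ {M G X Y} → Step N M G X → Step N M G Y → X ≗ Y
  Step-functional (_ , _ , X≡) (_ , _ , Y≡) s = trans (X≡ s) (sym (Y≡ s))

  Fires-functional : ∀ {M M' σ X Y} → M ≗ M' → Fires N M σ X → Fires N M' σ Y → X ≗ Y
  Fires-functional M≗M' done       done         = M≗M'
  Fires-functional M≗M' (step s r) (step s' r') =
    Fires-functional (Step-functional (Step-respˡ M≗M' s) s') r r'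

  Fires-++ : ∀ {M M₁ M₂ α β} → Fires N M α M₁ → Fires N M₁ β M₂ → Fires N M (α ++ β) M₂
  Fires-++ done       r' = r'
  Fires-++ (step s r) r' = step s (Fires-++ r r')

  Fires-++⁻ : ∀ α {β M M₂} → Fires N M (α ++ β) M₂ → ∃ λ M₁ → Fires N M α M₁ × Fires N M₁ β M₂
  Fires-++⁻ []      r = _ , done , r
  Fires-++⁻ (x ∷ α) (step s r) with Fires-++⁻ α r
  ... | M₁ , r₁ , r₂ = M₁ , step s r₁ , r₂

  FiresInf-cons : ∀ {M M₁ f} → Step N M (f 0 ∷ []) M₁ → FiresInf N M₁ (f ∘ suc) → FiresInf N M f
  FiresInf-cons {M₁ = M₁} s₀ (Ms , s₁ , sₙ) =
    (λ { zero → M₁ ; (suc n) → Ms n }) , s₀ , λ { zero → s₁ ; (suc n) → sₙ n }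

  FiresInf-uncons : ∀ {M f} → FiresInf N M f → ∃ λ M₁ → Step N M (f 0 ∷ []) M₁ × FiresInf N M₁ (f ∘ suc)
  FiresInf-uncons (Ms , s₀ , sₙ) = Ms 0 , s₀ , (Ms ∘ suc , sₙ 0 , sₙ ∘ suc)

  FiresInf-++ω : ∀ {M M₁ α f} → Fires N M α M₁ → FiresInf N M₁ f → FiresInf N M (α ++ω f)
  FiresInf-++ω done       fi = fi
  FiresInf-++ω {α = α} {f} (step s r) fi = FiresInf-cons {f = α ++ω f} s (FiresInf-++ω r fi)

  FiresInf-++ω⁻ : ∀ α {M f} → FiresInf N M (α ++ω f) → ∃ λ M₁ → Fires N M α M₁ × FiresInf N M₁ f
  FiresInf-++ω⁻ []      fi = _ , done , fi
  FiresInf-++ω⁻ (x ∷ α) {f = f} fi with FiresInf-uncons {f = (x ∷ α) ++ω f} fi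
  ... | _ , s , fi' with FiresInf-++ω⁻ α fi'
  ...   | M₁ , r , fi'' = M₁ , step s r , fi''

  Fireable-++w : ∀ {M M₁ α} w → Fires N M α M₁ → Fireable M₁ w → Fireable M (α ++w w)
  Fireable-++w (fin _) r (_ , r') = _ , Fires-++ r r'
  Fireable-++w (inf _) r fi       = FiresInf-++ω r fi

  Fireable-++w⁻ : ∀ α w {M} → Fireable M (α ++w w) → ∃ λ M₁ → Fires N M α M₁ × Fireable M₁ w
  Fireable-++w⁻ α (fin _) (_ , r) with Fires-++⁻ α r
  ... | M₁ , r₁ , r₂ = M₁ , r₁ , (_ , r₂)
  Fireable-++w⁻ α (inf _) fi = FiresInf-++ω⁻ α fi

  Fireable-respˡ : ∀ {M M'} w → M ≗ M' → Fireable M w → Fireable M' w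
  Fireable-respˡ (fin [])      M≗M' _               = _ , done
  Fireable-respˡ (fin (_ ∷ _)) M≗M' (_ , step s r)  = _ , step (Step-respˡ M≗M' s) r
  Fireable-respˡ (inf _)       M≗M' (Ms , s₀ , sₙ)  = Ms , Step-respˡ M≗M' s₀ , sₙ

  Fireable-≈w : ∀ {M} {w w' : Word T} → w ≈w w' → Fireable M w → Fireable M w'
  Fireable-≈w {w = fin _} {fin _} refl e = e
  Fireable-≈w {M} {inf f} {inf g} f≗g (Ms , s₀ , sₙ) =
    Ms , subst (λ x → Step N M (x ∷ []) (Ms 0)) (f≗g 0) s₀ ,
    λ n → subst (λ x → Step N (Ms n) (x ∷ []) (Ms (suc n))) (f≗g (suc n)) (sₙ n)

  FSω-≈w : {w w' : Word T} → w ≈w w' → FSω N w → FSω N w'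
  FSω-≈w {w} {w'} e = Fireable→FSω w' ∘ Fireable-≈w e ∘ FSω→Fireable w

  FSω-takeW : ∀ m w → FSω N w → FS N (takeW m w)
  FSω-takeW m w fw with Fireable-++w⁻ (takeW m w) (dropW m w)
                          (Fireable-≈w (takeW++dropW m w) (FSω→Fireable w fw))
  ... | _ , r , _ = _ , r

  Step-swap : ∀ {M M' A X t u} → Step N M (t ∷ u ∷ []) M' → Step N M (u ∷ []) A → Step N A (t ∷ []) X
            → ∃ λ Y → Step N M (t ∷ []) Y × Step N Y (u ∷ []) X
  Step-swap {M} {X = X} {t} {u} (_ , •tu≤M , _) (_ , _ , A≡) (_ , _ , X≡) =
    Y , ((λ ()) , •t≤M , λ _ → refl) , ((λ ()) , •u≤Y , X≡')
    where
    •t •u t• u• Y : Marking N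
    •t = preM N (t ∷ [])
    •u = preM N (u ∷ [])
    t• = postM N (t ∷ [])
    u• = postM N (u ∷ [])
    Y s = M s ∸ •t s + t• s

    •t+•u≤M : ∀ s → •t s + •u s ≤ M s
    •t+•u≤M s = subst (_≤ M s) (sum-++ (pre t s ∷ []) (pre u s ∷ [])) (•tu≤M s)

    •t≤M : ∀ s → •t s ≤ M s
    •t≤M s = m+n≤o⇒m≤o (•t s) (•t+•u≤M s)

    •u≤Y : ∀ s → •u s ≤ Y s
    •u≤Y s = m≤n⇒m≤n+o (t• s) (m+n≤o⇒m≤o∸n (•u s) (subst (_≤ M s) (+-comm (•t s) (•u s)) (•t+•u≤M s)))

    X≡' : ∀ s → X s ≡ Y s ∸ •u s + u• s
    X≡' s = trans (X≡ s) (trans (cong (λ a → a ∸ •t s + t• s) (A≡ s))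
                  ([m∸q+d]∸p+c≡[m∸p+c]∸q+d (M s) (•t s) (•u s) (t• s) (u• s) (•t+•u≤M s)))

  Fireable-swap : ∀ {M M' t u} w → Step N M (t ∷ u ∷ []) M'
                → Fireable M ((u ∷ t ∷ []) ++w w) → Fireable M ((t ∷ u ∷ []) ++w w)
  Fireable-swap {t = t} {u} w tu-concurrent e with Fireable-++w⁻ (u ∷ t ∷ []) w e
  ... | _ , step su (step st done) , e' with Step-swap tu-concurrent su st
  ...   | _ , st' , su' = Fireable-++w w (step st' (step su' done)) e'

  ≡₀*-FSωˡ : ∀ {w w'} → _≡₀*_ N w w' → FSω N w' → FSω N w
  ≡₀*-FSωˡ ε           fw' = fw'
  ≡₀*-FSωˡ (w≡₀w₁ ◅ _) _   = proj₁ w≡₀w₁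

  ≡₀-respʳ : ∀ {w w' w''} → _≡₀_ N w w' → w' ≈w w'' → _≡₀_ N w w''
  ≡₀-respʳ (fw , fw' , α , t , u , β , M , e , e' , swap) w'≈w'' =
    fw , FSω-≈w w'≈w'' fw' , α , t , u , β , M , e , ≈w-trans (≈w-sym w'≈w'') e' , swap

  ≡₀-takeW : ∀ {w w'} → _≡₀_ N w w'
           → ∃ λ L → ∀ m → L ≤ m → _≡₀_ N (fin (takeW m w)) (fin (takeW m w'))
  ≡₀-takeW {w} {w'} (fw , fw' , α , t , u , β , M , e , e' , swap) =
    2 + length α , λ m le →
      FSω-takeW m w fw , FSω-takeW m w' fw' ,
      α , t , u , fin (takeW (m ∸ length α ∸ 2) β) , M , take-swapped m le e , take-swapped m le e' , swap
    where
    take-swapped : ∀ {v} {x y : T} m → 2 + length α ≤ m → v ≈w (α ++w ((x ∷ y ∷ []) ++w β))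
                 → takeW m v ≡ α ++ (x ∷ y ∷ takeW (m ∸ length α ∸ 2) β)
    take-swapped {x = x} {y} m le e =
      trans (takeW-≈++w m e (m+n≤o⇒n≤o 2 le))
            (cong (α ++_) (takeW-≈++w (m ∸ length α) (≈w-refl {w = (x ∷ y ∷ []) ++w β}) (m+n≤o⇒m≤o∸n 2 le)))

  ≡₀*-takeW : ∀ {w w'} → _≡₀*_ N w w' → ∀ n
            → ∃ λ m → n ≤ m × _≡₀*_ N (fin (takeW m w)) (fin (takeW m w'))
  ≡₀*-takeW ε n = n , ≤-refl , ε
  ≡₀*-takeW (w≡₀w₁ ◅ w₁≡₀*w') n with ≡₀-takeW w≡₀w₁
  ... | L , prefixes≡₀ with ≡₀*-takeW w₁≡₀*w' (L + n)
  ...   | m , L+n≤m , chain = m , m+n≤o⇒n≤o L L+n≤m , prefixes≡₀ m (m+n≤o⇒m≤o L L+n≤m) ◅ chain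

  ¬fin≡₀inf : ∀ {a f} → ¬ _≡₀_ N (fin a) (inf f)
  ¬fin≡₀inf (_ , _ , _ , _ , _ , fin _ , _ , _ , () , _)
  ¬fin≡₀inf (_ , _ , _ , _ , _ , inf _ , _ , () , _)

  ≡₀-++w : ∀ γ {a b} → _≡₀_ N (fin a) (fin b) → FSω N (b ++w γ) → _≡₀_ N (a ++w γ) (b ++w γ)
  ≡₀-++w γ (_ , _ , _ , _ , _ , inf _ , _ , () , _)
  ≡₀-++w γ (_ , _ , α , t , u , fin β , M , refl , refl , fα , (M' , tu-concurrent)) fb =
    fa , fb , α , t , u , β ++w γ , M , reassoc t u , reassoc u t , fα , (M' , tu-concurrent)
    where
    reassoc : ∀ x y → ((α ++ x ∷ y ∷ β) ++w γ) ≈w (α ++w ((x ∷ y ∷ []) ++w (β ++w γ)))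
    reassoc x y = ≈w-trans (++w-assoc α (x ∷ y ∷ β) γ) (++w-congʳ α (++w-assoc (x ∷ y ∷ []) β γ))

    fa : FSω N ((α ++ t ∷ u ∷ β) ++w γ)
    fa with Fireable-++w⁻ α ((u ∷ t ∷ []) ++w (β ++w γ)) (Fireable-≈w (reassoc u t) (FSω→Fireable _ fb))
    ... | _ , fα' , rest =
      FSω-≈w (≈w-sym (reassoc t u))
        (Fireable→FSω _ (Fireable-++w _ fα
          (Fireable-swap (β ++w γ) tu-concurrent
            (Fireable-respˡ _ (Fires-functional (λ _ → refl) fα' fα) rest))))

  ≡₀*-++w : ∀ γ {a b ρ} → _≡₀*_ N (fin a) (fin b) → ρ ≈w (b ++w γ) → FSω N ρ
          → ∃ λ ρ† → ρ† ≈w (a ++w γ) × _≡₀*_ N ρ† ρ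
  ≡₀*-++w γ {ρ = ρ} ε ρ≈ _ = ρ , ρ≈ , ε
  ≡₀*-++w γ (_◅_ {j = inf _} a≡₀w _) _ _ = ⊥-elim (¬fin≡₀inf a≡₀w)
  ≡₀*-++w γ {a} (_◅_ {j = fin c} a≡₀c c≡₀*b) ρ≈ fρ with ≡₀*-++w γ c≡₀*b ρ≈ fρ
  ... | w , w≈ , w≡₀*ρ =
    a ++w γ , ≈w-refl , ≡₀-respʳ (≡₀-++w γ a≡₀c (FSω-≈w w≈ (≡₀*-FSωˡ w≡₀*ρ fρ))) (≈w-sym w≈) ◅ w≡₀*ρ

lemma2 : (N : Net) (σ'' : List (Net.T N)) (ρ : Word (Net.T N))
    → FS N σ'' → FSω N ρ
    → (Σ (Word (Net.T N)) λ ρ† → FSω N ρ† × (σ'' ≼ ρ†) × _≡₀*_ N ρ† ρ)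
    ⇔ (Σ (List (Net.T N)) λ σ' → Σ (List (Net.T N)) λ ρ' →
    FS N σ' × FS N ρ' × (σ'' ≼ fin σ') × _≡₀*_ N (fin σ') (fin ρ') × (ρ' ≼ ρ))
lemma2 N σ'' ρ _ fρ = mk⇔
  (λ (ρ† , fρ† , σ''≼ρ† , ρ†≡₀*ρ) →
    let m , |σ''|≤m , prefixes≡₀* = ≡₀*-takeW N ρ†≡₀*ρ (length σ'') in
    takeW m ρ† , takeW m ρ , FSω-takeW N m ρ† fρ† , FSω-takeW N m ρ fρ ,
    ≼-takeW m σ''≼ρ† |σ''|≤m , prefixes≡₀* , takeW-≼ m ρ)
  (λ (σ' , ρ' , _ , _ , σ''≼σ' , σ'≡₀*ρ' , γ , ρ≈ρ'γ) →
    let ρ† , ρ†≈σ'γ , ρ†≡₀*ρ = ≡₀*-++w N γ σ'≡₀*ρ' ρ≈ρ'γ fρ in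
    ρ† , ≡₀*-FSωˡ N ρ†≡₀*ρ fρ , ≼-≈++w σ''≼σ' ρ†≈σ'γ , ρ†≡₀*ρ)
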